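{- Let $n\geq 3$ and $\vec{x}\in\mathbb{Z}^n$. If $k(\vec{x})=n$ (i.e. $\vec{x}(1)>\vec{x}(2)>\cdots>\vec{x}(n)$), then $f(\vec{x})=\vec{x}(1)$. If $k(\vec{x})<n$, then $f(\vec{x})=\max(\vec{x}(l(\vec{x})+2),\vec{x}(k(\vec{x})+1))$.
   Context: For $\vec{x}=\langle x_1,\ldots,x_n\rangle$ write $\vec{x}(i)=x_i$. Define $k(\vec{x})=n$ if $\vec{x}(1)>\cdots>\vec{x}(n)$; otherwise $k(\vec{x})$ is the least $k$ with $\vec{x}(k)\leq\vec{x}(k+1)$. Define $l(\vec{x})$ as the least $l$ with $1\leq l<k(\vec{x})$ such that $\vec{x}(l)>\vec{x}(l+1)+1$ and $\vec{x}(l+1)=\vec{x}(l+2)+1$, if it exists; otherwise $l(\vec{x})=k(\vec{x})-1$. The function $g_b$ on integer sequences $\langle x_1,\ldots,x_j\rangle$: if $j\leq 3$ then $g_b(x_1,\ldots,x_j)=x_j$; otherwise if $x_1=x_2+1$ or $x_2>x_3+1$ then $g_b(x_1,\ldots,x_j)=g_b(x_2,\ldots,x_j)$, else $g_b(x_1,\ldots,x_j)=\max\{x_3,x_j\}$. The Bailey–Cowles function $f$ on $\mathbb{Z}^n$: if there is $k<n$ with $x_1>x_2>\cdots>x_k\leq x_{k+1}$, then $f(x_1,\ldots,x_n)=g_b(x_1,\ldots,x_{k+1})$; otherwise $f(x_1,\ldots,x_n)=x_1$. -}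

module Defs where

open import Data.Nat using (ℕ; zero; suc; _∸_; _+_)
open import Data.Integer using (ℤ; _≤?_; _<?_; _≟_; _⊔_; 0ℤ) renaming (_+_ to _+ℤ_)
open import Data.List using (List; []; _∷_; take)
open import Data.Bool using (Bool; true; false; if_then_else_; _∧_; _∨_)
open import Data.Maybe using (Maybe; just; nothing)
import Data.Maybe as Maybe
open import Relation.Nullary.Decidable using (⌊_⌋)

-- 1-based access  x(i) ; returns 0 outside the range 1..length x
-- (only ever used at in-range indices in the statement)
at : List ℤ → ℕ → ℤ
at []       _             = 0ℤ
at (a ∷ _)  1             = a
at (_ ∷ xs) (suc (suc i)) = at xs (suc i)
at (_ ∷ _)  zero          = 0ℤ

kOf : List ℤ → ℕ
kOf []           = 0
kOf (a ∷ [])     = 1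
kOf (a ∷ b ∷ r)  = if ⌊ a ≤? b ⌋ then 1 else suc (kOf (b ∷ r))

pat : List ℤ → ℕ → Bool
pat x l = ⌊ (at x (suc l) +ℤ 1ℤ') <? at x l ⌋ ∧ ⌊ at x (suc l) ≟ (at x (suc (suc l)) +ℤ 1ℤ') ⌋
  where
  1ℤ' : ℤ
  1ℤ' = Data.Integer.+ 1

lsearch : List ℤ → ℕ → ℕ → ℕ → ℕ
lsearch x l zero    d = d
lsearch x l (suc m) d = if pat x l then l else lsearch x (suc l) m d

lOf : List ℤ → ℕ
lOf x = lsearch x 1 (kOf x ∸ 1) (kOf x ∸ 1)

lastOr : ℤ → List ℤ → ℤ
lastOr d []       = d
lastOr d (a ∷ xs) = lastOr a xs

-- g_b(x_1,…,x_j)  (value on the empty sequence is irrelevant, set to 0)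
gb : List ℤ → ℤ
gb []                 = 0ℤ
gb (a ∷ [])           = a
gb (a ∷ b ∷ [])       = b
gb (a ∷ b ∷ c ∷ [])   = c
gb (x1 ∷ x2 ∷ x3 ∷ x4 ∷ r) =
  if ⌊ x1 ≟ (x2 +ℤ Data.Integer.+ 1) ⌋ ∨ ⌊ (x3 +ℤ Data.Integer.+ 1) <? x2 ⌋
  then gb (x2 ∷ x3 ∷ x4 ∷ r)
  else x3 ⊔ lastOr x4 r

breakPt : List ℤ → Maybe ℕ
breakPt (a ∷ b ∷ r) = if ⌊ a ≤? b ⌋ then just 1 else Maybe.map suc (breakPt (b ∷ r))
breakPt _           = nothing

-- Bailey–Cowles function f (value on the empty sequence irrelevant, set to 0)
f : List ℤ → ℤ
f x with breakPt x
... | just k  = gb (take (suc k) x)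
... | nothing = at x 1

-- Let k = k(x) < n. While x(1) > x(2) > x(3), the test that makes g_b drop x(1),
-- "x(1) = x(2)+1 or x(2) > x(3)+1", is exactly the negation of the pattern that
-- defines l(x) at position 1.  So g_b(x(1),…,x(k+1)) discards x(1), x(2), … for as long
-- as the pattern fails; it stops at position l(x), where it returns
-- max(x(l+2), x(k+1)); if the pattern never occurs, fewer than four entries remain
-- and g_b returns x(k+1) = max(x(k+1), x(k+1)).
module Submission where

open import Defs
open import Data.Nat using (ℕ; _≤_; _<_; _+_)
open import Data.Integer using (ℤ; _⊔_)
open import Data.List using (List; length)
open import Data.Product using (_×_)
open import Relation.Binary.PropositionalEquality using (_≡_)

open import Data.Nat using (zero; suc; z≤n; s≤s)
import Data.Nat.Properties as ℕ
import Data.Integer as ℤ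
open import Data.Integer using (1ℤ)
import Data.Integer.Properties as ℤ
open import Data.List using ([]; _∷_; take)
open import Data.Bool using (Bool; true; false; not; _∧_; _∨_; if_then_else_)
open import Data.Bool.Properties using (not-involutive; if-not; ∨-∧-booleanAlgebra)
open import Algebra.Lattice.Properties.BooleanAlgebra ∨-∧-booleanAlgebra using (deMorgan₂)
open import Data.Maybe using (just; nothing)
import Data.Maybe as Maybe
open import Data.Product using (∃; _,_; map)
open import Function using (_∘_)
open import Relation.Nullary using (Dec; ¬_; yes; no; contradiction)
open import Relation.Nullary.Decidable using (⌊_⌋; isYes≗does; dec-true; dec-false)
open import Relation.Binary.PropositionalEquality using (refl; sym; trans; cong; cong₂; module ≡-Reasoning)

private
  variable
    a b c d : ℤ
    r s : List ℤ
    m : ℕ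

⌊⌋-yes : ∀ {p} {P : Set p} (P? : Dec P) → P → ⌊ P? ⌋ ≡ true
⌊⌋-yes P? x = trans (isYes≗does P?) (dec-true P? x)

⌊⌋-no : ∀ {p} {P : Set p} (P? : Dec P) → ¬ P → ⌊ P? ⌋ ≡ false
⌊⌋-no P? ¬x = trans (isYes≗does P?) (dec-false P? ¬x)

i<j⇒i+1≤j : ∀ {i j} → i ℤ.< j → i ℤ.+ 1ℤ ℤ.≤ j
i<j⇒i+1≤j {i} i<j rewrite ℤ.+-comm i 1ℤ = ℤ.i<j⇒suc[i]≤j i<j

-- Since i + 1 ≤ j, exactly one of i + 1 < j and j ≡ i + 1 holds.
⌊i+1<?j⌋≡not⌊j≟i+1⌋ : ∀ {i j} → i ℤ.< j → ⌊ i ℤ.+ 1ℤ ℤ.<? j ⌋ ≡ not ⌊ j ℤ.≟ i ℤ.+ 1ℤ ⌋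
⌊i+1<?j⌋≡not⌊j≟i+1⌋ {i} {j} i<j with i ℤ.+ 1ℤ ℤ.<? j | j ℤ.≟ i ℤ.+ 1ℤ
... | yes i+1<j | yes j≡i+1 = contradiction i+1<j (ℤ.<-irrefl (sym j≡i+1))
... | yes _     | no _      = refl
... | no _      | yes _     = refl
... | no i+1≮j  | no j≢i+1  = contradiction (ℤ.≤∧≢⇒< (i<j⇒i+1≤j i<j) (j≢i+1 ∘ sym)) i+1≮j

⌊j≟i+1⌋≡not⌊i+1<?j⌋ : ∀ {i j} → i ℤ.< j → ⌊ j ℤ.≟ i ℤ.+ 1ℤ ⌋ ≡ not ⌊ i ℤ.+ 1ℤ ℤ.<? j ⌋
⌊j≟i+1⌋≡not⌊i+1<?j⌋ {i} {j} i<j =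
  trans (sym (not-involutive _)) (cong not (sym (⌊i+1<?j⌋≡not⌊j≟i+1⌋ i<j)))

dropsHead : ℤ → ℤ → ℤ → Bool
dropsHead a b c = ⌊ a ℤ.≟ b ℤ.+ 1ℤ ⌋ ∨ ⌊ c ℤ.+ 1ℤ ℤ.<? b ⌋

pat-1≡not-dropsHead : b ℤ.< a → c ℤ.< b → pat (a ∷ b ∷ c ∷ r) 1 ≡ not (dropsHead a b c)
pat-1≡not-dropsHead {b} {a} {c} b<a c<b = begin
  ⌊ b ℤ.+ 1ℤ ℤ.<? a ⌋ ∧ ⌊ b ℤ.≟ c ℤ.+ 1ℤ ⌋
    ≡⟨ cong₂ _∧_ (⌊i+1<?j⌋≡not⌊j≟i+1⌋ b<a) (⌊j≟i+1⌋≡not⌊i+1<?j⌋ c<b) ⟩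
  not ⌊ a ℤ.≟ b ℤ.+ 1ℤ ⌋ ∧ not ⌊ c ℤ.+ 1ℤ ℤ.<? b ⌋
    ≡⟨ sym (deMorgan₂ ⌊ a ℤ.≟ b ℤ.+ 1ℤ ⌋ ⌊ c ℤ.+ 1ℤ ℤ.<? b ⌋) ⟩
  not (dropsHead a b c) ∎
  where open ≡-Reasoning

gb-descent : b ℤ.< a → c ℤ.< b →
  gb (a ∷ b ∷ c ∷ d ∷ s) ≡ (if pat (a ∷ b ∷ c ∷ r) 1 then c ⊔ lastOr d s else gb (b ∷ c ∷ d ∷ s))
gb-descent {b} {a} {c} {r = r} b<a c<b rewrite pat-1≡not-dropsHead {r = r} b<a c<b =
  sym (if-not (dropsHead a b c))

lastOr-take : ∀ j → j ≤ length r → lastOr a (take j r) ≡ at (a ∷ r) (suc j)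
lastOr-take             zero    _         = refl
lastOr-take {b ∷ r} {a} (suc j) (s≤s j≤n) = lastOr-take {r} {b} j j≤n

-- DescentRun x m : x(1) > x(2) > ⋯ > x(m+1) ≤ x(m+2), so that k(x) = m + 1 < length x.
data DescentRun : List ℤ → ℕ → Set where
  ascent  : a ℤ.≤ b → DescentRun (a ∷ b ∷ r) 0
  descent : b ℤ.< a → DescentRun (b ∷ r) m → DescentRun (a ∷ b ∷ r) (suc m)

kOf<length⇒DescentRun : ∀ x → kOf x < length x → ∃ (DescentRun x)
kOf<length⇒DescentRun (a ∷ []) (s≤s ())
kOf<length⇒DescentRun (a ∷ b ∷ r) k<n with a ℤ.≤? b | kOf<length⇒DescentRun (b ∷ r)
... | yes a≤b | _   = 0 , ascent a≤b
... | no a≰b  | rec = map suc (descent (ℤ.≰⇒> a≰b)) (rec (ℕ.≤-pred k<n))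

DescentRun⇒kOf : ∀ {x} → DescentRun x m → kOf x ≡ suc m
DescentRun⇒kOf (ascent {a} {b} a≤b) rewrite ⌊⌋-yes (a ℤ.≤? b) a≤b = refl
DescentRun⇒kOf (descent {b} {a} b<a run)
  rewrite ⌊⌋-no (a ℤ.≤? b) (ℤ.<⇒≱ b<a) | DescentRun⇒kOf run = refl

DescentRun⇒length : ∀ {x} → DescentRun x m → suc (suc m) ≤ length x
DescentRun⇒length (ascent _)      = s≤s (s≤s z≤n)
DescentRun⇒length (descent _ run) = s≤s (DescentRun⇒length run)

DescentRun⇒breakPt : ∀ {x} → DescentRun x m → breakPt x ≡ just (suc m)
DescentRun⇒breakPt (ascent {a} {b} a≤b) rewrite ⌊⌋-yes (a ℤ.≤? b) a≤b = refl
DescentRun⇒breakPt (descent {b} {a} b<a run)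
  rewrite ⌊⌋-no (a ℤ.≤? b) (ℤ.<⇒≱ b<a) | DescentRun⇒breakPt run = refl

DescentRun⇒f : ∀ {x} → DescentRun x m → f x ≡ gb (take (suc (suc m)) x)
DescentRun⇒f {x = x} run with breakPt x | DescentRun⇒breakPt run
... | just _ | refl = refl

kOf≡length⇒breakPt≡nothing : ∀ x → kOf x ≡ length x → breakPt x ≡ nothing
kOf≡length⇒breakPt≡nothing []          _ = refl
kOf≡length⇒breakPt≡nothing (a ∷ [])    _ = refl
kOf≡length⇒breakPt≡nothing (a ∷ b ∷ r) k≡n with a ℤ.≤? b | kOf≡length⇒breakPt≡nothing (b ∷ r)
... | yes _ | _   = contradiction k≡n λ ()
... | no _  | rec = cong (Maybe.map suc) (rec (ℕ.suc-injective k≡n))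

lsearch-∷ : ∀ x l j d → lsearch (a ∷ x) (suc (suc l)) j (suc d) ≡ suc (lsearch x (suc l) j d)
lsearch-∷     x l zero    d = refl
lsearch-∷ {a} x l (suc j) d with pat x (suc l)
... | true  = refl
... | false = lsearch-∷ {a} x (suc l) j d

lOf-kOf≡1 : ∀ x → kOf x ≡ 1 → lOf x ≡ 0
lOf-kOf≡1 x k≡1 rewrite k≡1 = refl

lOf-kOf≡2 : ∀ x → kOf x ≡ 2 → lOf x ≡ 1
lOf-kOf≡2 x k≡2 rewrite k≡2 with pat x 1
... | true  = refl
... | false = refl

lOf-pat : ∀ x → kOf x ≡ suc (suc m) → pat x 1 ≡ true → lOf x ≡ 1
lOf-pat x k≡ p rewrite k≡ | p = refl

lOf-∷ : b ℤ.< a → kOf (b ∷ r) ≡ suc m → pat (a ∷ b ∷ r) 1 ≡ false →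
  lOf (a ∷ b ∷ r) ≡ suc (lOf (b ∷ r))
lOf-∷ {b} {a} {r} {m} b<a k≡ ¬p
  rewrite ⌊⌋-no (a ℤ.≤? b) (ℤ.<⇒≱ b<a) | k≡ | ¬p = lsearch-∷ (b ∷ r) 0 m m

gb-prefix : ∀ {x} → DescentRun x m →
  gb (take (suc (suc m)) x) ≡ at x (suc (suc (lOf x))) ⊔ at x (suc (suc m))
gb-prefix {x = x} run@(ascent {b = b} _)
  rewrite lOf-kOf≡1 x (DescentRun⇒kOf run) = sym (ℤ.⊔-idem b)
gb-prefix {x = x} run@(descent _ (ascent {b = c} _))
  rewrite lOf-kOf≡2 x (DescentRun⇒kOf run) = sym (ℤ.⊔-idem c)
gb-prefix {x = _ ∷ _ ∷ _ ∷ []} (descent _ (descent _ ()))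
-- The recursive call precedes the rewrite so that the termination checker sees run₁ as a subterm.
gb-prefix {x = x@(a ∷ b ∷ c ∷ d ∷ r)} run@(descent b<a run₁@(descent {m = m} c<b run₂))
  with gb-prefix run₁
... | ih rewrite gb-descent {d = d} {s = take m r} {r = d ∷ r} b<a c<b
  with pat x 1 in p
... | true  rewrite lOf-pat x (DescentRun⇒kOf run) p =
  cong (c ⊔_) (lastOr-take m (ℕ.≤-pred (ℕ.≤-pred (DescentRun⇒length run₂))))
... | false = trans ih
  (cong (λ l → at x (suc (suc l)) ⊔ at x (suc (suc (suc (suc m)))))
        (sym (lOf-∷ b<a (DescentRun⇒kOf run₁) p)))

lemma2p2 : (n : ℕ) → 3 ≤ n → (x : List ℤ) → length x ≡ n →
    (kOf x ≡ n → f x ≡ at x 1) ×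
    (kOf x < n → f x ≡ at x (lOf x + 2) ⊔ at x (kOf x + 1))
lemma2p2 n _ x refl = decreasing , breaking
  where
  decreasing : kOf x ≡ length x → f x ≡ at x 1
  decreasing k≡n with breakPt x | kOf≡length⇒breakPt≡nothing x k≡n
  ... | nothing | _ = refl

  breaking : kOf x < length x → f x ≡ at x (lOf x + 2) ⊔ at x (kOf x + 1)
  breaking k<n with m , run ← kOf<length⇒DescentRun x k<n = begin
    f x                                           ≡⟨ DescentRun⇒f run ⟩
    gb (take (suc (suc m)) x)                     ≡⟨ gb-prefix run ⟩
    at x (suc (suc (lOf x))) ⊔ at x (suc (suc m)) ≡⟨ cong₂ (λ i j → at x i ⊔ at x j) (ℕ.+-comm 2 (lOf x)) k+1≡ ⟩
    at x (lOf x + 2) ⊔ at x (kOf x + 1)           ∎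
    where
    open ≡-Reasoning
    k+1≡ : suc (suc m) ≡ kOf x + 1
    k+1≡ = trans (cong suc (sym (DescentRun⇒kOf run))) (ℕ.+-comm 1 (kOf x))
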